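{- Let $P$ be a finite poset and let $Q\subseteq 2^{[n]}$ be a copy of $P$. (1) If $x\in Q$ is minimal in $Q$ and $f\in[n]$ is special for $x$, then for every $x'\in 2^{[n]}$ satisfying $f\in x'\subseteq x$, the family $(Q-\{x\})\cup\{x'\}$ is also a copy of $P$. (2) If $y\in Q$ is maximal in $Q$ and $f\in[n]$ is special for $y$, then for every $y'\in 2^{[n]}$ satisfying $y\subseteq y'$ and $f\notin y'$, the family $(Q-\{y\})\cup\{y'\}$ is also a copy of $P$.
   Context: $2^{[n]}$ is ordered by inclusion; a copy of $P$ is a subfamily whose induced subposet is isomorphic to $P$. For a copy $Q$ of $P$ in $2^{[n]}$ and $x\in Q$, a base element $f\in[n]$ is special for $x$ if either (a) $x$ is minimal in $Q$, $f\in x$, and every $y\in Q$ containing $f$ satisfies $x\subseteq y$; or (b) $x$ is maximal in $Q$, $f\notin x$, and every $y\in Q$ not containing $f$ satisfies $y\subseteq x$. -}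

module Defs where

open import Level using (Level; _⊔_; suc; zero)
open import Data.Nat using (ℕ)
open import Data.Fin using (Fin)
open import Data.Fin.Subset using (Subset; _∈_; _∉_; _⊆_)
open import Data.Product using (Σ; ∃; _×_)
open import Data.Sum using (_⊎_)
open import Relation.Nullary using (¬_)
open import Relation.Binary.Bundles using (Poset)
open import Relation.Binary.PropositionalEquality using (_≡_; _≢_)
open import Function.Bundles using (_↔_)

Family : ℕ → Set₁
Family n = Subset n → Set

IsFinitePoset : ∀ {c ℓ₁ ℓ₂} → Poset c ℓ₁ ℓ₂ → Set c
IsFinitePoset P = ∃ λ m → Poset.Carrier P ↔ Fin m

IsCopy : ∀ {c ℓ₁ ℓ₂} (P : Poset c ℓ₁ ℓ₂) {n : ℕ} → Family n → Set (c ⊔ ℓ₁ ⊔ ℓ₂)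
IsCopy P {n} Q =
  Σ (Poset.Carrier P → Subset n) λ φ →
      (∀ p → Q (φ p))
    × (∀ z → Q z → ∃ λ p → φ p ≡ z)
    × (∀ p q → φ p ≡ φ q → Poset._≈_ P p q)
    × (∀ p q → (Poset._≤_ P p q → φ p ⊆ φ q) × (φ p ⊆ φ q → Poset._≤_ P p q))

IsMinimal : ∀ {n} → Family n → Subset n → Set
IsMinimal Q x = Q x × (∀ y → Q y → y ⊆ x → y ≡ x)

IsMaximal : ∀ {n} → Family n → Subset n → Set
IsMaximal Q x = Q x × (∀ y → Q y → x ⊆ y → y ≡ x)

IsSpecial : ∀ {n} → Family n → Subset n → Fin n → Set
IsSpecial Q x f =
    (IsMinimal Q x × f ∈ x × (∀ y → Q y → f ∈ y → x ⊆ y))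
  ⊎ (IsMaximal Q x × f ∉ x × (∀ y → Q y → f ∉ y → y ⊆ x))

Replace : ∀ {n} → Family n → Subset n → Subset n → Family n
Replace Q x x' z = (Q z × z ≢ x) ⊎ z ≡ x'

module Submission where

-- A copy of P is transported along any map ψ that restricts to an order
-- isomorphism from Q onto Q' (`transport-copy`); injectivity of the new
-- embedding comes for free from antisymmetry of P.  The map that sends
-- x to x' and fixes everything else is such an isomorphism from Q onto
-- (Q - {x}) ∪ {x'} as soon as every other member z of Q compares with x'
-- exactly as it compares with x (`replace-orderIso`).

open import Defs
open import Data.Nat using (ℕ)
open import Data.Bool using () renaming (_≟_ to _≟ᵇ_)
open import Data.Fin using (Fin)
open import Data.Fin.Subset using (Subset; _∈_; _∉_; _⊆_)
open import Data.Fin.Subset.Properties using (⊆-refl; ⊆-reflexive; ⊆-trans)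
open import Data.Vec.Properties using (≡-dec)
open import Data.Product using (_×_; _,_; ∃; proj₁; proj₂)
open import Data.Sum using (_⊎_; inj₁; inj₂)
open import Data.Empty using (⊥-elim)
open import Relation.Nullary using (yes; no)
open import Relation.Binary.Bundles using (Poset)
open import Relation.Binary.PropositionalEquality using (_≡_; _≢_; refl; sym; trans; cong)
open import Function.Bundles using (_⇔_; mk⇔; Equivalence)
import Function.Properties.Equivalence as ⇔

open Equivalence using (to; from)

record OrderIsoOnto {n : ℕ} (Q Q' : Family n) (ψ : Subset n → Subset n) : Set where
  field
    maps-into : ∀ z → Q z → Q' (ψ z)
    onto      : ∀ z' → Q' z' → ∃ λ z → Q z × ψ z ≡ z'
    embedding : ∀ a b → Q a → Q b → (a ⊆ b ⇔ ψ a ⊆ ψ b)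

transport-copy : ∀ {c ℓ₁ ℓ₂} (P : Poset c ℓ₁ ℓ₂) {n : ℕ} {Q Q' : Family n}
                 {ψ : Subset n → Subset n} →
                 OrderIsoOnto Q Q' ψ → IsCopy P Q → IsCopy P Q'
transport-copy P {Q' = Q'} {ψ} iso (φ , φ∈Q , φ-onto , _ , φ-order) =
  (λ p → ψ (φ p)) , (λ p → maps-into (φ p) (φ∈Q p)) , covers , injective , order
  where
  open OrderIsoOnto iso
  open Poset P using (_≈_; _≤_; antisym)

  ψφ-embedding : ∀ p q → φ p ⊆ φ q ⇔ ψ (φ p) ⊆ ψ (φ q)
  ψφ-embedding p q = embedding (φ p) (φ q) (φ∈Q p) (φ∈Q q)

  monotone : ∀ p q → p ≤ q → ψ (φ p) ⊆ ψ (φ q)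
  monotone p q p≤q = to (ψφ-embedding p q) (proj₁ (φ-order p q) p≤q)

  reflecting : ∀ p q → ψ (φ p) ⊆ ψ (φ q) → p ≤ q
  reflecting p q ψφ⊆ = proj₂ (φ-order p q) (from (ψφ-embedding p q) ψφ⊆)

  order : ∀ p q → (p ≤ q → ψ (φ p) ⊆ ψ (φ q)) × (ψ (φ p) ⊆ ψ (φ q) → p ≤ q)
  order p q = monotone p q , reflecting p q

  -- Equal images are mutually included, so antisymmetry of P applies.
  injective : ∀ p q → ψ (φ p) ≡ ψ (φ q) → p ≈ q
  injective p q eq =
    antisym (reflecting p q (⊆-reflexive eq)) (reflecting q p (⊆-reflexive (sym eq)))

  covers : ∀ z' → Q' z' → ∃ λ p → ψ (φ p) ≡ z'
  covers z' z'∈Q' with onto z' z'∈Q'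
  ... | z , z∈Q , ψz≡z' with φ-onto z z∈Q
  ... | p , φp≡z = p , trans (cong ψ φp≡z) ψz≡z'

replaceBy : ∀ {n} → Subset n → Subset n → Subset n → Subset n
replaceBy x x' z with ≡-dec _≟ᵇ_ z x
... | yes _ = x'
... | no  _ = z

replaceBy-cases : ∀ {n} (x x' z : Subset n) →
                  (z ≡ x × replaceBy x x' z ≡ x') ⊎ (z ≢ x × replaceBy x x' z ≡ z)
replaceBy-cases x x' z with ≡-dec _≟ᵇ_ z x
... | yes z≡x = inj₁ (z≡x , refl)
... | no  z≢x = inj₂ (z≢x , refl)

CompatibleReplacement : ∀ {n} → Family n → Subset n → Subset n → Set
CompatibleReplacement Q x x' =
  ∀ z → Q z → z ≢ x → (z ⊆ x ⇔ z ⊆ x') × (x ⊆ z ⇔ x' ⊆ z)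

replace-orderIso : ∀ {n} {Q : Family n} {x x' : Subset n} → Q x →
                   CompatibleReplacement Q x x' →
                   OrderIsoOnto Q (Replace Q x x') (replaceBy x x')
replace-orderIso {Q = Q} {x} {x'} x∈Q compatible = record
  { maps-into = maps-into ; onto = onto ; embedding = embedding }
  where
  ρ : Subset _ → Subset _
  ρ = replaceBy x x'

  maps-into : ∀ z → Q z → Replace Q x x' (ρ z)
  maps-into z z∈Q with replaceBy-cases x x' z
  ... | inj₁ (_ , ρz≡x')   = inj₂ ρz≡x'
  ... | inj₂ (z≢x , ρz≡z) rewrite ρz≡z = inj₁ (z∈Q , z≢x)

  onto : ∀ z' → Replace Q x x' z' → ∃ λ z → Q z × ρ z ≡ z'
  onto z' (inj₁ (z'∈Q , z'≢x)) with replaceBy-cases x x' z'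
  ... | inj₁ (z'≡x , _)  = ⊥-elim (z'≢x z'≡x)
  ... | inj₂ (_ , ρz'≡z') = z' , z'∈Q , ρz'≡z'
  onto z' (inj₂ z'≡x') with replaceBy-cases x x' x
  ... | inj₁ (_ , ρx≡x') = x , x∈Q , trans ρx≡x' (sym z'≡x')
  ... | inj₂ (x≢x , _)   = ⊥-elim (x≢x refl)

  embedding : ∀ a b → Q a → Q b → (a ⊆ b ⇔ ρ a ⊆ ρ b)
  embedding a b a∈Q b∈Q with replaceBy-cases x x' a | replaceBy-cases x x' b
  ... | inj₁ (refl , ρa) | inj₁ (refl , _) rewrite ρa =
          mk⇔ {A = a ⊆ a} {B = x' ⊆ x'} (λ _ → ⊆-refl) (λ _ → ⊆-refl)
  ... | inj₁ (refl , ρa) | inj₂ (b≢x , ρb) rewrite ρa | ρb = proj₂ (compatible b b∈Q b≢x)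
  ... | inj₂ (a≢x , ρa) | inj₁ (refl , ρb) rewrite ρa | ρb = proj₁ (compatible a a∈Q a≢x)
  ... | inj₂ (_ , ρa) | inj₂ (_ , ρb) rewrite ρa | ρb = ⇔.refl

-- Shrinking a minimal member x to any x' with f ∈ x' ⊆ x, where every
-- member containing f lies above x, is compatible: nothing else lies below
-- x or x', and lying above x' forces containing f, hence lying above x.
shrink-minimal-compatible : ∀ {n} {Q : Family n} {x x' : Subset n} {f : Fin n} →
                            IsMinimal Q x → (∀ y → Q y → f ∈ y → x ⊆ y) →
                            f ∈ x' → x' ⊆ x → CompatibleReplacement Q x x'
shrink-minimal-compatible {x = x} {x'} (_ , minimal) special f∈x' x'⊆x z z∈Q z≢x =
  mk⇔ below-x below-x' , mk⇔ above-x above-x'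
  where
  below-x : z ⊆ x → z ⊆ x'
  below-x z⊆x = ⊥-elim (z≢x (minimal z z∈Q z⊆x))

  below-x' : z ⊆ x' → z ⊆ x
  below-x' z⊆x' = ⊆-trans z⊆x' x'⊆x

  above-x : x ⊆ z → x' ⊆ z
  above-x = ⊆-trans x'⊆x

  above-x' : x' ⊆ z → x ⊆ z
  above-x' x'⊆z = special z z∈Q (x'⊆z f∈x')

grow-maximal-compatible : ∀ {n} {Q : Family n} {y y' : Subset n} {f : Fin n} →
                          IsMaximal Q y → (∀ z → Q z → f ∉ z → z ⊆ y) →
                          y ⊆ y' → f ∉ y' → CompatibleReplacement Q y y'
grow-maximal-compatible {y = y} {y'} (_ , maximal) special y⊆y' f∉y' z z∈Q z≢y =
  mk⇔ below-y below-y' , mk⇔ above-y above-y'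
  where
  below-y : z ⊆ y → z ⊆ y'
  below-y z⊆y = ⊆-trans z⊆y y⊆y'

  below-y' : z ⊆ y' → z ⊆ y
  below-y' z⊆y' = special z z∈Q (λ f∈z → f∉y' (z⊆y' f∈z))

  above-y : y ⊆ z → y' ⊆ z
  above-y y⊆z = ⊥-elim (z≢y (maximal z z∈Q y⊆z))

  above-y' : y' ⊆ z → y ⊆ z
  above-y' y'⊆z = ⊆-trans y⊆y' y'⊆z

claim5 : ∀ {c ℓ₁ ℓ₂} (P : Poset c ℓ₁ ℓ₂) → IsFinitePoset P →
         ∀ {n : ℕ} (Q : Family n) → IsCopy P Q →
         (∀ (x : Subset n) (f : Fin n) → IsMinimal Q x → IsSpecial Q x f →
            ∀ (x' : Subset n) → f ∈ x' → x' ⊆ x → IsCopy P (Replace Q x x'))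
         ×
         (∀ (y : Subset n) (f : Fin n) → IsMaximal Q y → IsSpecial Q y f →
            ∀ (y' : Subset n) → y ⊆ y' → f ∉ y' → IsCopy P (Replace Q y y'))
claim5 P _ Q copy = shrink , grow
  where
  shrink : ∀ x f → IsMinimal Q x → IsSpecial Q x f →
           ∀ x' → f ∈ x' → x' ⊆ x → IsCopy P (Replace Q x x')
  shrink x f min@(x∈Q , _) (inj₁ (_ , _ , special)) x' f∈x' x'⊆x =
    transport-copy P
      (replace-orderIso x∈Q (shrink-minimal-compatible min special f∈x' x'⊆x)) copy
  shrink x f _ (inj₂ (_ , f∉x , _)) x' f∈x' x'⊆x = ⊥-elim (f∉x (x'⊆x f∈x'))

  grow : ∀ y f → IsMaximal Q y → IsSpecial Q y f →
         ∀ y' → y ⊆ y' → f ∉ y' → IsCopy P (Replace Q y y')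
  grow y f max@(y∈Q , _) (inj₂ (_ , _ , special)) y' y⊆y' f∉y' =
    transport-copy P
      (replace-orderIso y∈Q (grow-maximal-compatible max special y⊆y' f∉y')) copy
  grow y f _ (inj₁ (_ , f∈y , _)) y' y⊆y' f∉y' = ⊥-elim (f∉y' (y⊆y' f∈y))
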